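{- If $u$ is a reduced sequence with $\mathit{fw}(u)=3$, then either there exists some $l \geq 2$ for which $u$ is isomorphic to $\mathit{up}(l, 2)$, or $u$ is isomorphic to one of the sequences $aaa$, $aabb$, $abba$, $abcacb$, $abcbac$, $abccab$, $abcdbadc$ (where $a,b,c,d$ are distinct letters).
   Context: A sequence $s$ contains a sequence $u$ if some subsequence of $s$ can be changed into $u$ by a one-to-one renaming of its letters; two sequences are isomorphic if one is obtained from the other by a one-to-one renaming of letters. An $(r,s)$-formation is a concatenation of $s$ permutations of the same set of $r$ distinct letters. The formation width $\mathit{fw}(u)$ is the minimum $s$ such that there exists $r$ for which every $(r,s)$-formation contains $u$. A sequence is reduced if every distinct letter in it occurs at least twice. $\mathit{up}(l,2)$ is the sequence $1\,2\ldots l\,1\,2\ldots l$. -}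

module Defs where

open import Data.Nat using (ℕ; zero; suc; _≤_; _<_; _≟_)
open import Data.List using (List; []; _∷_; map; length; filter; concat; upTo)
open import Data.List.Membership.Propositional using (_∈_)
open import Data.List.Relation.Unary.All using (All)
open import Data.List.Relation.Unary.Unique.Propositional using (Unique)
open import Data.List.Relation.Binary.Sublist.Propositional using (_⊆_)
open import Data.List.Relation.Binary.Permutation.Propositional using (_↭_)
open import Data.Product using (Σ; ∃; ∃-syntax; _×_)
open import Relation.Binary.PropositionalEquality using (_≡_)
open import Relation.Nullary using (¬_)

Seq : Set
Seq = List ℕ

count : ℕ → Seq → ℕ
count x w = length (filter (x ≟_) w)

InjectiveOn : (ℕ → ℕ) → Seq → Set
InjectiveOn f v = ∀ x y → x ∈ v → y ∈ v → f x ≡ f y → x ≡ y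

Isomorphic : Seq → Seq → Set
Isomorphic u v = ∃[ f ] (InjectiveOn f v × map f v ≡ u)

Contains : Seq → Seq → Set
Contains s u = ∃[ v ] (v ⊆ s × Isomorphic u v)

IsFormation : ℕ → ℕ → Seq → Set
IsFormation r s w =
  ∃[ L ] (Unique L × length L ≡ r ×
    ∃[ blocks ] (length blocks ≡ s × All (_↭ L) blocks × concat blocks ≡ w))

FormationForces : ℕ → Seq → Set
FormationForces s u = ∃[ r ] (∀ w → IsFormation r s w → Contains w u)

FwEq : Seq → ℕ → Set
FwEq u s = FormationForces s u × (∀ t → t < s → ¬ FormationForces t u)

Reduced : Seq → Set
Reduced u = ∀ x → x ∈ u → 2 ≤ count x u

up2 : ℕ → Seq
up2 l = map suc (upTo l) Data.List.++ map suc (upTo l)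

-- the exceptional sequences with a = 0, b = 1, c = 2, d = 3
s-aaa s-aabb s-abba s-abcacb s-abcbac s-abccab s-abcdbadc : Seq
s-aaa = 0 ∷ 0 ∷ 0 ∷ []
s-aabb = 0 ∷ 0 ∷ 1 ∷ 1 ∷ []
s-abba = 0 ∷ 1 ∷ 1 ∷ 0 ∷ []
s-abcacb = 0 ∷ 1 ∷ 2 ∷ 0 ∷ 2 ∷ 1 ∷ []
s-abcbac = 0 ∷ 1 ∷ 2 ∷ 1 ∷ 0 ∷ 2 ∷ []
s-abccab = 0 ∷ 1 ∷ 2 ∷ 2 ∷ 0 ∷ 1 ∷ []
s-abcdbadc = 0 ∷ 1 ∷ 2 ∷ 3 ∷ 1 ∷ 0 ∷ 3 ∷ 2 ∷ []

-- If every (r,3)-formation contains u, so do the monotone ones, whose three blocks are the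
-- increasing or the decreasing run 0 … r-1; hence, for each of the eight choices of directions, u is
-- a renaming of a concatenation of three monotone runs.  Such a presentation exists only if the
-- order constraints between consecutive letters of the runs are acyclic.  Checking this on the
-- canonical forms of all reduced sequences of length at most 8 leaves aa, abab, abcabc, abcdabcd and
-- the seven exceptions, and aa is excluded because fw(aa) = 2.  A longer u is controlled through its
-- restrictions to at most four letters, which are short and hence on that list: every letter occurs
-- exactly twice, any two letters cross (abab) or nest (abba), and a nested pair would force some
-- letter to nest with two others.  So all pairs cross, which makes u a square p p with p
-- duplicate-free, i.e. a copy of up(l,2).

module Submission where

open import Defs
open import Data.Nat using (ℕ; zero; suc; pred; _+_; _*_; _≤_; _<_; _>_; z≤n; s≤s; s≤s⁻¹; _≟_; _≤?_; _≡ᵇ_; _≤ᵇ_)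
open import Data.Nat.Properties
  using (≤-refl; ≤-trans; ≤-reflexive; <-irrefl; <-≤-trans; ≤-<-trans; <⇒≤; <⇒≱; ≰⇒>; ≤ᵇ⇒≤; ≤⇒≤ᵇ; ≡ᵇ⇒≡;
         +-comm; +-mono-≤; +-commutativeSemigroup; m≤m+n; suc-injective)
open import Algebra.Properties.CommutativeSemigroup +-commutativeSemigroup using (interchange)
open import Data.Bool using (Bool; true; false; T; not; _∨_; _∧_)
open import Data.Bool.ListAction using (all; any)
open import Data.Bool.Properties using (T-∨; T-∧)
open import Data.Empty using (⊥; ⊥-elim)
open import Data.List
  using (List; []; _∷_; _++_; [_]; map; length; concat; concatMap; filter; replicate; upTo; downFrom; applyUpTo)
open import Data.List.Properties
  using (∷-injective; ∷-injectiveˡ; ∷-injectiveʳ; ++-identityʳ; ++-assoc; ++-cancelˡ; length-++; length-map;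
         length-downFrom; map-++; map-∘; map-upTo; reverse-downFrom; filter-accept; filter-reject; filter-++;
         filter-all; ≡-dec)
open import Data.List.Membership.Propositional using (_∈_; _∉_; find)
open import Data.List.Membership.Propositional.Properties
  using (∈-map⁺; ∈-map⁻; ∈-++⁺ˡ; ∈-++⁺ʳ; ∈-++⁻; ∈-concatMap⁺; ∈-upTo⁺; ∈-upTo⁻; ∈-filter⁺; ∈-filter⁻)
open import Data.List.Membership.DecPropositional _≟_ using (_∈?_)
open import Data.List.Membership.DecPropositional (≡-dec _≟_) using () renaming (_∈?_ to _∈ₛ?_)
open import Data.List.Relation.Unary.Any as Any using (Any; here; there)
open import Data.List.Relation.Unary.Any.Properties using (any⁺; any⁻)
open import Data.List.Relation.Unary.All as All using (All; []; _∷_; all?)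
open import Data.List.Relation.Unary.All.Properties as Allₚ using (all⁺; all⁻; replicate⁺; ¬All⇒Any¬; ¬Any⇒All¬)
open import Data.List.Relation.Unary.AllPairs using (AllPairs; []; _∷_)
open import Data.List.Relation.Unary.AllPairs.Properties using (applyUpTo⁺₁; applyDownFrom⁺₁)
open import Data.List.Relation.Unary.Unique.Propositional using (Unique)
open import Data.List.Relation.Unary.Unique.Propositional.Properties as Uniqueₚ using (downFrom⁺)
open import Data.List.Relation.Unary.Unique.DecPropositional _≟_ using (unique?)
open import Data.List.Relation.Binary.Pointwise as Pointwise using (Pointwise; []; _∷_)
open import Data.List.Relation.Binary.Sublist.Propositional using (_⊆_; _⊇_; []; _∷_; _∷ʳ_; ⊆-refl)
open import Data.List.Relation.Binary.Sublist.Propositional.Properties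
  using (All-resp-⊆; Any-resp-⊆; filter-⊆; ++⁺; length-mono-≤; []⊆-universal)
open import Data.List.Relation.Binary.Permutation.Propositional using (_↭_; ↭-refl)
open import Data.List.Relation.Binary.Permutation.Propositional.Properties using (↭-reverse; ↭-singleton-inv)
open import Data.Product using (_×_; _,_; proj₁; proj₂; ∃-syntax; map₁)
open import Data.Sum as Sum using (_⊎_; inj₁; inj₂)
open import Function using (_∘_; Equivalence)
open import Relation.Binary using (Rel; _Respects_)
open import Relation.Binary.PropositionalEquality
  using (_≡_; _≢_; refl; sym; trans; cong; cong₂; subst; module ≡-Reasoning)
open import Relation.Nullary using (¬_; ¬?; Dec; yes; no; _→-dec_; _⊎-dec_)
open import Relation.Nullary.Decidable using (isYes; toWitness)

private variable A B : Set

-- Monotone formations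

data Dir : Set where
  inc dec : Dir

Monotone : Dir → Seq → Set
Monotone inc = AllPairs _<_
Monotone dec = AllPairs _>_

Runs : List Dir → Seq → Set
Runs ds v = ∃[ vs ] (Pointwise Monotone ds vs × concat vs ≡ v)

Realizable : List Dir → Seq → Set
Realizable ds u = ∃[ v ] (Runs ds v × Isomorphic u v)

AllRealizable₃ : Seq → Set
AllRealizable₃ u = ∀ d₁ d₂ d₃ → Realizable (d₁ ∷ d₂ ∷ d₃ ∷ []) u

run : Dir → ℕ → Seq
run inc r = upTo r
run dec r = downFrom r

run-monotone : ∀ d r → Monotone d (run d r)
run-monotone inc r = applyUpTo⁺₁ _ r (λ i<j _ → i<j)
run-monotone dec r = applyDownFrom⁺₁ _ r (λ j<i _ → j<i)

run-↭ : ∀ d r → run d r ↭ downFrom r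
run-↭ inc r = subst (_↭ downFrom r) (reverse-downFrom r) (↭-reverse (downFrom r))
run-↭ dec r = ↭-refl

formation : List Dir → ℕ → Seq
formation ds r = concat (map (λ d → run d r) ds)

formation-isFormation : ∀ ds r → IsFormation r (length ds) (formation ds r)
formation-isFormation ds r =
  downFrom r , downFrom⁺ r , length-downFrom r ,
  map (λ d → run d r) ds , length-map _ ds ,
  Allₚ.map⁺ (All.universal (λ d → run-↭ d r) ds) , refl

AllPairs-resp-⊆ : ∀ {a ℓ} {A : Set a} {R : Rel A ℓ} → (AllPairs R) Respects _⊇_
AllPairs-resp-⊆ [] [] = []
AllPairs-resp-⊆ (y ∷ʳ τ) (_ ∷ ps) = AllPairs-resp-⊆ τ ps
AllPairs-resp-⊆ (refl ∷ τ) (p ∷ ps) = All-resp-⊆ τ p ∷ AllPairs-resp-⊆ τ ps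

Monotone-resp-⊆ : ∀ d → Monotone d Respects _⊇_
Monotone-resp-⊆ inc = AllPairs-resp-⊆
Monotone-resp-⊆ dec = AllPairs-resp-⊆

++-⊆⁻ : ∀ (xs ys : List A) {v} → v ⊆ xs ++ ys → ∃[ v₁ ] ∃[ v₂ ] (v₁ ⊆ xs × v₂ ⊆ ys × v₁ ++ v₂ ≡ v)
++-⊆⁻ [] ys τ = [] , _ , [] , τ , refl
++-⊆⁻ (x ∷ xs) ys (.x ∷ʳ τ) with ++-⊆⁻ xs ys τ
... | v₁ , v₂ , τ₁ , τ₂ , eq = v₁ , v₂ , x ∷ʳ τ₁ , τ₂ , eq
++-⊆⁻ (x ∷ xs) ys (refl ∷ τ) with ++-⊆⁻ xs ys τ
... | v₁ , v₂ , τ₁ , τ₂ , refl = x ∷ v₁ , v₂ , refl ∷ τ₁ , τ₂ , refl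

concat-⊆⁻ : ∀ (ws : List (List A)) {v} → v ⊆ concat ws → ∃[ vs ] (Pointwise _⊇_ ws vs × concat vs ≡ v)
concat-⊆⁻ [] [] = [] , [] , refl
concat-⊆⁻ (w ∷ ws) τ with ++-⊆⁻ w (concat ws) τ
... | v₁ , v₂ , τ₁ , τ₂ , refl with concat-⊆⁻ ws τ₂
... | vs , τs , refl = v₁ ∷ vs , τ₁ ∷ τs , refl

Runs-resp-⊆ : ∀ ds → Runs ds Respects _⊇_
Runs-resp-⊆ ds τ (vs , ms , refl) with concat-⊆⁻ vs τ
... | vs′ , τs , eq = vs′ , Pointwise.transitive (λ m τ′ → Monotone-resp-⊆ _ τ′ m) ms τs , eq

map-⊆⁻ : ∀ (f : A → B) v {w} → w ⊆ map f v → ∃[ v′ ] (v′ ⊆ v × map f v′ ≡ w)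
map-⊆⁻ f [] [] = [] , [] , refl
map-⊆⁻ f (x ∷ v) (.(f x) ∷ʳ τ) with map-⊆⁻ f v τ
... | v′ , τ′ , eq = v′ , x ∷ʳ τ′ , eq
map-⊆⁻ f (x ∷ v) (refl ∷ τ) with map-⊆⁻ f v τ
... | v′ , τ′ , refl = x ∷ v′ , refl ∷ τ′ , refl

Realizable-resp-⊆ : ∀ ds → Realizable ds Respects _⊇_
Realizable-resp-⊆ ds τ (v , runs , f , inj , refl) with map-⊆⁻ f v τ
... | v′ , τ′ , eq =
  v′ , Runs-resp-⊆ ds τ′ runs , f , (λ x y x∈ y∈ → inj x y (Any-resp-⊆ τ′ x∈) (Any-resp-⊆ τ′ y∈)) , eq

AllRealizable₃-resp-⊆ : AllRealizable₃ Respects _⊇_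
AllRealizable₃-resp-⊆ τ real d₁ d₂ d₃ = Realizable-resp-⊆ _ τ (real d₁ d₂ d₃)

formation-runs : ∀ ds r → Runs ds (formation ds r)
formation-runs ds r = map (λ d → run d r) ds , monotone ds , refl
  where
  monotone : ∀ ds → Pointwise Monotone ds (map (λ d → run d r) ds)
  monotone [] = []
  monotone (d ∷ ds) = run-monotone d r ∷ monotone ds

forces⇒realizable : ∀ ds {u} → FormationForces (length ds) u → Realizable ds u
forces⇒realizable ds (r , forces) with forces (formation ds r) (formation-isFormation ds r)
... | v , τ , iso = v , Runs-resp-⊆ ds τ (formation-runs ds r) , iso


-- A sound test for realizability

Edge : Set
Edge = ℕ × ℕ

Increases : (ℕ → ℕ) → Edge → Set
Increases a (x , y) = a x < a y

orient : Dir → ℕ → ℕ → Edge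
orient inc x y = x , y
orient dec x y = y , x

edges : Dir → Seq → List Edge
edges d (x ∷ y ∷ c) = orient d x y ∷ edges d (y ∷ c)
edges d _ = []

edges-sound : ∀ a d c → Monotone d (map a c) → All (Increases a) (edges d c)
edges-sound a d [] _ = []
edges-sound a d (x ∷ []) _ = []
edges-sound a inc (x ∷ y ∷ c) ((ax<ay ∷ _) ∷ run) = ax<ay ∷ edges-sound a inc (y ∷ c) run
edges-sound a dec (x ∷ y ∷ c) ((ax>ay ∷ _) ∷ run) = ax>ay ∷ edges-sound a dec (y ∷ c) run

reaches : ℕ → List Edge → ℕ → ℕ → Bool
reaches zero E x y = x ≡ᵇ y
reaches (suc n) E x y = (x ≡ᵇ y) ∨ any (λ e → (proj₁ e ≡ᵇ x) ∧ reaches n E (proj₂ e) y) E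

reaches-sound : ∀ a n E x y → All (Increases a) E → T (reaches n E x y) → a x ≤ a y
reaches-sound a zero E x y _ t with ≡ᵇ⇒≡ x y t
... | refl = ≤-refl
reaches-sound a (suc n) E x y incr t with Equivalence.to T-∨ t
... | inj₁ x≡ᵇy with ≡ᵇ⇒≡ x y x≡ᵇy
...   | refl = ≤-refl
reaches-sound a (suc n) E x y incr t | inj₂ t′ = step (any⁻ _ E t′)
  where
  step : Any (T ∘ λ e → (proj₁ e ≡ᵇ x) ∧ reaches n E (proj₂ e) y) E → a x ≤ a y
  step p with Any.lookup p | All.lookupAny incr p
  ... | (x′ , z) | ax′<az , t″ with Equivalence.to T-∧ t″
  ...   | x′≡ᵇx , z→y with ≡ᵇ⇒≡ x′ x x′≡ᵇx
  ...     | refl = <⇒≤ (<-≤-trans ax′<az (reaches-sound a n E z y incr z→y))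

-- Soundness holds for any search depth; depth 4 is what the finite search needs.
hasCycle : List Edge → Bool
hasCycle E = any (λ e → reaches 4 E (proj₂ e) (proj₁ e)) E

hasCycle-sound : ∀ a E → All (Increases a) E → ¬ T (hasCycle E)
hasCycle-sound a E incr t with any⁻ _ E t
... | p with Any.lookup p | All.lookupAny incr p
... | (x , y) | ax<ay , y→x = <-irrefl refl (<-≤-trans ax<ay (reaches-sound a 4 E y x incr y→x))

splits : List A → List (List A × List A)
splits [] = ([] , []) ∷ []
splits (x ∷ c) = ([] , x ∷ c) ∷ map (map₁ (x ∷_)) (splits c)

splits-complete : ∀ (c₁ c₂ : List A) → (c₁ , c₂) ∈ splits (c₁ ++ c₂)
splits-complete [] [] = here refl
splits-complete [] (_ ∷ _) = here refl
splits-complete (x ∷ c₁) c₂ = there (∈-map⁺ (map₁ (x ∷_)) (splits-complete c₁ c₂))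

map-++⁻ : ∀ (a : A → B) c v {w} → v ++ w ≡ map a c →
          ∃[ c₁ ] ∃[ c₂ ] (c₁ ++ c₂ ≡ c × map a c₁ ≡ v × map a c₂ ≡ w)
map-++⁻ a c [] eq = [] , c , refl , refl , sym eq
map-++⁻ a (x ∷ c) (y ∷ v) eq with map-++⁻ a c v (∷-injectiveʳ eq)
... | c₁ , c₂ , refl , refl , refl = x ∷ c₁ , c₂ , refl , cong (_∷ _) (sym (∷-injectiveˡ eq)) , refl

-- E collects the order constraints imposed by the runs cut off so far.
realizable? : List Dir → List Edge → Seq → Bool
realizable? [] E [] = not (hasCycle E)
realizable? [] E (_ ∷ _) = false
realizable? (d ∷ ds) E c = any (λ s → realizable? ds (edges d (proj₁ s) ++ E) (proj₂ s)) (splits c)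

realizable?-sound : ∀ a ds E c → All (Increases a) E → Runs ds (map a c) → T (realizable? ds E c)
realizable?-sound a [] E [] incr _ with hasCycle E | hasCycle-sound a E incr
... | false | _ = _
... | true | acyclic = ⊥-elim (acyclic _)
realizable?-sound a [] E (x ∷ c) incr ([] , [] , ())
realizable?-sound a (d ∷ ds) E c incr (v ∷ vs , m ∷ ms , eq) with map-++⁻ a c v eq
... | c₁ , c₂ , refl , refl , eq₂ =
  any⁺ _ (Any.map (λ { refl → realizable?-sound a ds _ c₂ (Allₚ.++⁺ (edges-sound a d c₁ m) incr)
                                                             (vs , ms , sym eq₂) })
                  (splits-complete c₁ c₂))


-- Canonical forms

indexOf : ℕ → List ℕ → ℕ
indexOf a [] = 0
indexOf a (x ∷ X) with a ≟ x
... | yes _ = 0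
... | no _ = suc (indexOf a X)

-- 0 out of range
nth : List ℕ → ℕ → ℕ
nth [] i = 0
nth (x ∷ X) zero = x
nth (x ∷ X) (suc i) = nth X i

indexOf-∈ : ∀ {a} X → a ∈ X → indexOf a X < length X × nth X (indexOf a X) ≡ a
indexOf-∈ {a} (x ∷ X) a∈ with a ≟ x | a∈
... | yes refl | _ = s≤s z≤n , refl
... | no a≢x | here a≡x = ⊥-elim (a≢x a≡x)
... | no _ | there a∈X with indexOf-∈ X a∈X
...   | lt , eq = s≤s lt , eq

indexOf-∉ : ∀ {a} X → a ∉ X → indexOf a X ≡ length X
indexOf-∉ [] _ = refl
indexOf-∉ {a} (x ∷ X) a∉ with a ≟ x
... | yes refl = ⊥-elim (a∉ (here refl))
... | no _ = cong suc (indexOf-∉ X (a∉ ∘ there))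

nth-++ˡ : ∀ X Y {i} → i < length X → nth (X ++ Y) i ≡ nth X i
nth-++ˡ (x ∷ X) Y {zero} _ = refl
nth-++ˡ (x ∷ X) Y {suc i} (s≤s lt) = nth-++ˡ X Y lt

nth-∷ʳ : ∀ X a → nth (X ++ [ a ]) (length X) ≡ a
nth-∷ʳ [] a = refl
nth-∷ʳ (x ∷ X) a = nth-∷ʳ X a

nth-∈ : ∀ X {i} → i < length X → nth X i ∈ X
nth-∈ (x ∷ X) {zero} _ = here refl
nth-∈ (x ∷ X) {suc i} (s≤s lt) = there (nth-∈ X lt)

nth-injective : ∀ X {i j} → Unique X → i < length X → j < length X → nth X i ≡ nth X j → i ≡ j
nth-injective (x ∷ X) {zero} {zero} _ _ _ _ = refl
nth-injective (x ∷ X) {zero} {suc j} (x∉ ∷ _) _ (s≤s lt) eq = ⊥-elim (All.lookup x∉ (nth-∈ X lt) eq)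
nth-injective (x ∷ X) {suc i} {zero} (x∉ ∷ _) (s≤s lt) _ eq = ⊥-elim (All.lookup x∉ (nth-∈ X lt) (sym eq))
nth-injective (x ∷ X) {suc i} {suc j} (_ ∷ uX) (s≤s lt) (s≤s lt′) eq = cong suc (nth-injective X uX lt lt′ eq)

length-∷ʳ : ∀ (X : List ℕ) a → length (X ++ [ a ]) ≡ suc (length X)
length-∷ʳ X a = trans (length-++ X) (+-comm (length X) 1)

addLetter : List ℕ → ℕ → List ℕ
addLetter X a with a ∈? X
... | yes _ = X
... | no _ = X ++ [ a ]

relabel : List ℕ → Seq → Seq
relabel X [] = []
relabel X (a ∷ u) = indexOf a X ∷ relabel (addLetter X a) u

alphabet : List ℕ → Seq → List ℕ
alphabet X [] = X
alphabet X (a ∷ u) = alphabet (addLetter X a) u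

-- letters renamed 0, 1, 2, … in order of first occurrence
canon : Seq → Seq
canon = relabel []

addLetter-extends : ∀ X a → ∃[ Y ] (addLetter X a ≡ X ++ Y)
addLetter-extends X a with a ∈? X
... | yes _ = [] , sym (++-identityʳ X)
... | no _ = [ a ] , refl

alphabet-extends : ∀ X u → ∃[ Y ] (alphabet X u ≡ X ++ Y)
alphabet-extends X [] = [] , sym (++-identityʳ X)
alphabet-extends X (a ∷ u) with addLetter-extends X a | alphabet-extends (addLetter X a) u
... | Y , eq | Z , eq′ = Y ++ Z , trans eq′ (trans (cong (_++ Z) eq) (++-assoc X Y Z))

addLetter-indexOf : ∀ X a → indexOf a X < length (addLetter X a) × nth (addLetter X a) (indexOf a X) ≡ a
addLetter-indexOf X a with a ∈? X
... | yes a∈X = indexOf-∈ X a∈X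
... | no a∉X rewrite indexOf-∉ X a∉X = subst (length X <_) (sym (length-∷ʳ X a)) ≤-refl , nth-∷ʳ X a

relabel-decode : ∀ X u → map (nth (alphabet X u)) (relabel X u) ≡ u
relabel-decode X [] = refl
relabel-decode X (a ∷ u) with alphabet-extends (addLetter X a) u | addLetter-indexOf X a
... | Y , eq | lt , nth≡a = cong₂ _∷_ first (relabel-decode (addLetter X a) u)
  where
  first : nth (alphabet (addLetter X a) u) (indexOf a X) ≡ a
  first rewrite eq = trans (nth-++ˡ (addLetter X a) Y lt) nth≡a

relabel-bounded : ∀ X u {i} → i ∈ relabel X u → i < length (alphabet X u)
relabel-bounded X (a ∷ u) (here refl) with alphabet-extends (addLetter X a) u
... | Y , eq rewrite eq | length-++ (addLetter X a) {Y} =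
  <-≤-trans (proj₁ (addLetter-indexOf X a)) (m≤m+n _ _)
relabel-bounded X (a ∷ u) (there i∈) = relabel-bounded (addLetter X a) u i∈

addLetter-unique : ∀ X a → Unique X → Unique (addLetter X a)
addLetter-unique X a uX with a ∈? X
... | yes _ = uX
... | no a∉X = Uniqueₚ.++⁺ uX ([] ∷ []) λ { (a∈X , here refl) → a∉X a∈X }

alphabet-unique : ∀ X u → Unique X → Unique (alphabet X u)
alphabet-unique X [] uX = uX
alphabet-unique X (a ∷ u) uX = alphabet-unique (addLetter X a) u (addLetter-unique X a uX)

canon-isomorphic : ∀ u → Isomorphic u (canon u)
canon-isomorphic u =
  nth L ,
  (λ i j i∈ j∈ → nth-injective L (alphabet-unique [] u []) (relabel-bounded [] u i∈) (relabel-bounded [] u j∈)) ,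
  relabel-decode [] u
  where L = alphabet [] u

InjectiveOn-⊆ : ∀ {f v w} → (∀ {x} → x ∈ w → x ∈ v) → InjectiveOn f v → InjectiveOn f w
InjectiveOn-⊆ w⊆v inj x y x∈ y∈ = inj x y (w⊆v x∈) (w⊆v y∈)

indexOf-map : ∀ f a X → InjectiveOn f (a ∷ X) → indexOf (f a) (map f X) ≡ indexOf a X
indexOf-map f a [] inj = refl
indexOf-map f a (x ∷ X) inj with f a ≟ f x | a ≟ x
... | yes _ | yes _ = refl
... | yes fa≡fx | no a≢x = ⊥-elim (a≢x (inj a x (here refl) (there (here refl)) fa≡fx))
... | no fa≢fx | yes refl = ⊥-elim (fa≢fx refl)
... | no _ | no _ = cong suc (indexOf-map f a X (InjectiveOn-⊆ (Any-resp-⊆ (refl ∷ x ∷ʳ ⊆-refl)) inj))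

addLetter-map : ∀ f a X → InjectiveOn f (a ∷ X) → addLetter (map f X) (f a) ≡ map f (addLetter X a)
addLetter-map f a X inj with f a ∈? map f X | a ∈? X
... | yes _ | yes _ = refl
... | yes fa∈ | no a∉X with ∈-map⁻ f fa∈
...   | z , z∈X , fa≡fz = ⊥-elim (a∉X (subst (_∈ X) (sym (inj a z (here refl) (there z∈X) fa≡fz)) z∈X))
addLetter-map f a X inj | no fa∉ | yes a∈X = ⊥-elim (fa∉ (∈-map⁺ f a∈X))
addLetter-map f a X inj | no _ | no _ = sym (map-++ f X [ a ])

addLetter-⊆ : ∀ X a {z} → z ∈ addLetter X a → z ∈ a ∷ X
addLetter-⊆ X a z∈ with a ∈? X
... | yes _ = there z∈
... | no _ with ∈-++⁻ X z∈
...   | inj₁ z∈X = there z∈X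
...   | inj₂ (here refl) = here refl

relabel-map : ∀ f X v → InjectiveOn f (X ++ v) → relabel (map f X) (map f v) ≡ relabel X v
relabel-map f X [] inj = refl
relabel-map f X (a ∷ v) inj =
  cong₂ _∷_ (indexOf-map f a X (InjectiveOn-⊆ current inj))
            (trans (cong (λ Y → relabel Y (map f v)) (addLetter-map f a X (InjectiveOn-⊆ current inj)))
                   (relabel-map f (addLetter X a) v (InjectiveOn-⊆ rest inj)))
  where
  current : ∀ {z} → z ∈ a ∷ X → z ∈ X ++ a ∷ v
  current (here refl) = ∈-++⁺ʳ X (here refl)
  current (there z∈X) = ∈-++⁺ˡ z∈X
  rest : ∀ {z} → z ∈ addLetter X a ++ v → z ∈ X ++ a ∷ v
  rest z∈ with ∈-++⁻ (addLetter X a) z∈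
  ... | inj₁ z∈X′ = current (addLetter-⊆ X a z∈X′)
  ... | inj₂ z∈v = ∈-++⁺ʳ X (there z∈v)

canon-map : ∀ f v → InjectiveOn f v → canon (map f v) ≡ canon v
canon-map f v = relabel-map f [] v

-- restricted growth strings of length n, given that the letters 0 … m-1 are already in use
growthStrings : ℕ → ℕ → List Seq
growthStrings zero m = [] ∷ []
growthStrings (suc n) m =
  concatMap (λ i → map (i ∷_) (growthStrings n m)) (upTo m) ++ map (m ∷_) (growthStrings n (suc m))

relabel-growthString : ∀ X u → relabel X u ∈ growthStrings (length u) (length X)
relabel-growthString X [] = here refl
relabel-growthString X (a ∷ u) with a ∈? X
... | yes a∈X = ∈-++⁺ˡ (∈-concatMap⁺ _ (Any.map (λ { refl → ∈-map⁺ _ (relabel-growthString X u) })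
                                                (∈-upTo⁺ (proj₁ (indexOf-∈ X a∈X)))))
... | no a∉X rewrite indexOf-∉ X a∉X =
  ∈-++⁺ʳ _ (∈-map⁺ _ (subst (λ m → relabel (X ++ [ a ]) u ∈ growthStrings (length u) m)
                           (length-∷ʳ X a) (relabel-growthString (X ++ [ a ]) u)))

canon-growthString : ∀ u → canon u ∈ growthStrings (length u) 0
canon-growthString u = relabel-growthString [] u


-- Occurrences and restrictions

count-≡ : ∀ x w → count x (x ∷ w) ≡ suc (count x w)
count-≡ x w = cong length (filter-accept (x ≟_) refl)

count-≢ : ∀ {x y} w → x ≢ y → count x (y ∷ w) ≡ count x w
count-≢ w x≢y = cong length (filter-reject (_ ≟_) x≢y)

count-++ : ∀ x v w → count x (v ++ w) ≡ count x v + count x w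
count-++ x v w = trans (cong length (filter-++ (x ≟_) v w)) (length-++ (filter (x ≟_) v))

count-∉ : ∀ {x} w → x ∉ w → count x w ≡ 0
count-∉ [] _ = refl
count-∉ {x} (y ∷ w) x∉ with x ≟ y
... | yes refl = ⊥-elim (x∉ (here refl))
... | no x≢y = trans (count-≢ w x≢y) (count-∉ w (x∉ ∘ there))

count-map : ∀ g c {i} → InjectiveOn g c → i ∈ c → count (g i) (map g c) ≡ count i c
count-map g c {i} inj i∈ = go c (InjectiveOn-⊆ (λ { (here refl) → i∈ ; (there z∈) → z∈ }) inj)
  where
  go : ∀ c → InjectiveOn g (i ∷ c) → count (g i) (map g c) ≡ count i c
  go [] _ = refl
  go (x ∷ c) inj′ with i ≟ x | go c (InjectiveOn-⊆ (Any-resp-⊆ (refl ∷ x ∷ʳ ⊆-refl)) inj′)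
  ... | yes refl | IH = trans (count-≡ (g i) (map g c)) (trans (cong suc IH) (sym (count-≡ i c)))
  ... | no i≢x | IH = trans (count-≢ (map g c) (i≢x ∘ inj′ i x (here refl) (there (here refl))))
                            (trans IH (sym (count-≢ c i≢x)))

count-∈ : ∀ {x} w → x ∈ w → 1 ≤ count x w
count-∈ {x} (y ∷ w) x∈ with x ≟ y
... | yes refl = subst (1 ≤_) (sym (count-≡ x w)) (s≤s z≤n)
... | no x≢y with x∈
...   | here x≡y = ⊥-elim (x≢y x≡y)
...   | there x∈w = subst (1 ≤_) (sym (count-≢ w x≢y)) (count-∈ w x∈w)

count≡1⇒∉ : ∀ x w → count x (x ∷ w) ≡ 1 → x ∉ w
count≡1⇒∉ x w once x∈w with subst (1 ≤_) (suc-injective (trans (sym (count-≡ x w)) once)) (count-∈ w x∈w)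
... | ()

count>0⇒∈ : ∀ {x} w → 1 ≤ count x w → x ∈ w
count>0⇒∈ {x} w pos with x ∈? w
... | yes x∈ = x∈
... | no x∉ with subst (1 ≤_) (count-∉ w x∉) pos
...   | ()

count-replicate : ∀ x n → count x (replicate n x) ≡ n
count-replicate x zero = refl
count-replicate x (suc n) = trans (count-≡ x (replicate n x)) (cong suc (count-replicate x n))

replicate-⊆ : ∀ {a} n u → n ≤ count a u → replicate n a ⊆ u
replicate-⊆ zero u _ = []⊆-universal u
replicate-⊆ {a} (suc n) (y ∷ u) n<count with a ≟ y
... | yes refl = refl ∷ replicate-⊆ n u (s≤s⁻¹ (subst (suc n ≤_) (count-≡ a u) n<count))
... | no a≢y = y ∷ʳ replicate-⊆ (suc n) u (subst (suc n ≤_) (count-≢ u a≢y) n<count)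

infixl 6 _↾_

_↾_ : Seq → List ℕ → Seq
u ↾ S = filter (_∈? S) u

↾-⊆ : ∀ u S → u ↾ S ⊆ u
↾-⊆ u S = filter-⊆ (_∈? S) u

∈-↾⁺ : ∀ {x u S} → x ∈ u → x ∈ S → x ∈ u ↾ S
∈-↾⁺ = ∈-filter⁺ (_∈? _)

∈-↾⁻ : ∀ {x} u S → x ∈ u ↾ S → x ∈ u × x ∈ S
∈-↾⁻ u S = ∈-filter⁻ (_∈? S)

↾-++ : ∀ v w S → (v ++ w) ↾ S ≡ v ↾ S ++ w ↾ S
↾-++ v w S = filter-++ (_∈? S) v w

count-↾ : ∀ u S {x} → x ∈ S → count x (u ↾ S) ≡ count x u
count-↾ [] S _ = refl
count-↾ (y ∷ u) S {x} x∈S with y ∈? S | x ≟ y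
... | yes _ | yes refl = trans (count-≡ x (u ↾ S)) (trans (cong suc (count-↾ u S x∈S)) (sym (count-≡ x u)))
... | yes _ | no x≢y = trans (count-≢ (u ↾ S) x≢y) (trans (count-↾ u S x∈S) (sym (count-≢ u x≢y)))
... | no y∉S | yes refl = ⊥-elim (y∉S x∈S)
... | no _ | no x≢y = trans (count-↾ u S x∈S) (sym (count-≢ u x≢y))

↾-∷-∈ : ∀ y u S → y ∈ S → (y ∷ u) ↾ S ≡ y ∷ u ↾ S
↾-∷-∈ y u S = filter-accept (_∈? S)

↾-∷-∉ : ∀ y u S → y ∉ S → (y ∷ u) ↾ S ≡ u ↾ S
↾-∷-∉ y u S = filter-reject (_∈? S)

↾-↾ : ∀ u {S S′} → (∀ {x} → x ∈ S → x ∈ S′) → u ↾ S′ ↾ S ≡ u ↾ S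
↾-↾ [] _ = refl
↾-↾ (y ∷ u) {S} {S′} S⊆S′ = step (y ∈? S) (y ∈? S′)
  where
  IH = ↾-↾ u S⊆S′
  step : Dec (y ∈ S) → Dec (y ∈ S′) → (y ∷ u) ↾ S′ ↾ S ≡ (y ∷ u) ↾ S
  step (yes y∈S) _ = begin
    (y ∷ u) ↾ S′ ↾ S  ≡⟨ cong (_↾ S) (↾-∷-∈ y u S′ (S⊆S′ y∈S)) ⟩
    (y ∷ u ↾ S′) ↾ S  ≡⟨ ↾-∷-∈ y (u ↾ S′) S y∈S ⟩
    y ∷ u ↾ S′ ↾ S    ≡⟨ cong (y ∷_) IH ⟩
    y ∷ u ↾ S         ≡⟨ ↾-∷-∈ y u S y∈S ⟨
    (y ∷ u) ↾ S       ∎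
    where open ≡-Reasoning
  step (no y∉S) (yes y∈S′) = begin
    (y ∷ u) ↾ S′ ↾ S  ≡⟨ cong (_↾ S) (↾-∷-∈ y u S′ y∈S′) ⟩
    (y ∷ u ↾ S′) ↾ S  ≡⟨ ↾-∷-∉ y (u ↾ S′) S y∉S ⟩
    u ↾ S′ ↾ S        ≡⟨ IH ⟩
    u ↾ S             ≡⟨ ↾-∷-∉ y u S y∉S ⟨
    (y ∷ u) ↾ S       ∎
    where open ≡-Reasoning
  step (no y∉S) (no y∉S′) = begin
    (y ∷ u) ↾ S′ ↾ S  ≡⟨ cong (_↾ S) (↾-∷-∉ y u S′ y∉S′) ⟩
    u ↾ S′ ↾ S        ≡⟨ IH ⟩
    u ↾ S             ≡⟨ ↾-∷-∉ y u S y∉S ⟨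
    (y ∷ u) ↾ S       ∎
    where open ≡-Reasoning

↾-map : ∀ h S c → InjectiveOn h (S ++ c) → map h c ↾ map h S ≡ map h (c ↾ S)
↾-map h S [] inj = refl
↾-map h S (y ∷ c) inj with ↾-map h S c (InjectiveOn-⊆ (Any-resp-⊆ (++⁺ ⊆-refl (y ∷ʳ ⊆-refl))) inj)
                         | h y ∈? map h S | y ∈? S
... | ih | yes _ | yes _ = cong (h y ∷_) ih
... | ih | no _ | no _ = ih
... | _ | no hy∉ | yes y∈S = ⊥-elim (hy∉ (∈-map⁺ h y∈S))
... | _ | yes hy∈ | no y∉S with ∈-map⁻ h hy∈
...   | z , z∈S , hy≡hz = ⊥-elim (y∉S (subst (_∈ S) (sym (inj y z (∈-++⁺ʳ S (here refl)) (∈-++⁺ˡ z∈S) hy≡hz)) z∈S))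

↾-[] : ∀ u → u ↾ [] ≡ []
↾-[] [] = refl
↾-[] (y ∷ u) = trans (↾-∷-∉ y u [] λ ()) (↾-[] u)

private
  shift : ∀ {L C M L′ C′ M′} d₁ d₂ d₃ → d₁ ≤ d₂ + d₃ →
          L′ ≡ d₁ + L → C′ ≡ d₂ + C → M′ ≡ d₃ + M → L ≤ C + M → L′ ≤ C′ + M′
  shift _ d₂ d₃ d≤ refl refl refl L≤ = ≤-trans (+-mono-≤ d≤ L≤) (≤-reflexive (interchange d₂ d₃ _ _))

length-↾-∷ : ∀ u s S → length (u ↾ (s ∷ S)) ≤ count s u + length (u ↾ S)
length-↾-∷ [] s S = z≤n
length-↾-∷ (y ∷ u) s S = step (s ≟ y) (y ∈? S)
  where
  IH = length-↾-∷ u s S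
  step : Dec (s ≡ y) → Dec (y ∈ S) → length ((y ∷ u) ↾ (s ∷ S)) ≤ count s (y ∷ u) + length ((y ∷ u) ↾ S)
  step (yes refl) (yes y∈S) =
    shift 1 1 1 (s≤s z≤n) (cong length (↾-∷-∈ y u (s ∷ S) (here refl))) (count-≡ s u)
          (cong length (↾-∷-∈ y u S y∈S)) IH
  step (yes refl) (no y∉S) =
    shift 1 1 0 ≤-refl (cong length (↾-∷-∈ y u (s ∷ S) (here refl))) (count-≡ s u)
          (cong length (↾-∷-∉ y u S y∉S)) IH
  step (no s≢y) (yes y∈S) =
    shift 1 0 1 ≤-refl (cong length (↾-∷-∈ y u (s ∷ S) (there y∈S))) (count-≢ u s≢y)
          (cong length (↾-∷-∈ y u S y∈S)) IH
  step (no s≢y) (no y∉S) =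
    shift 0 0 0 z≤n (cong length (↾-∷-∉ y u (s ∷ S) λ { (here refl) → s≢y refl ; (there y∈S) → y∉S y∈S }))
          (count-≢ u s≢y) (cong length (↾-∷-∉ y u S y∉S)) IH

count-bounded : ∀ u {k} → (∀ {x} → x ∈ u → count x u ≤ k) → ∀ x → count x u ≤ k
count-bounded u bounded x with x ∈? u
... | yes x∈ = bounded x∈
... | no x∉ = subst (_≤ _) (sym (count-∉ u x∉)) z≤n

length-↾-≤ : ∀ u S {k} → (∀ x → count x u ≤ k) → length (u ↾ S) ≤ length S * k
length-↾-≤ u [] _ = ≤-reflexive (cong length (↾-[] u))
length-↾-≤ u (s ∷ S) bounded = ≤-trans (length-↾-∷ u s S) (+-mono-≤ (bounded s) (length-↾-≤ u S bounded))

fresh-letter : ∀ u S {k} → (∀ {x} → x ∈ u → count x u ≤ k) → length S * k < length u → ∃[ z ] (z ∈ u × z ∉ S)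
fresh-letter u S bounded long with all? (_∈? S) u
... | yes all∈ = ⊥-elim (<⇒≱ long (subst (λ w → length w ≤ _) (filter-all (_∈? S) all∈)
                                          (length-↾-≤ u S (count-bounded u bounded))))
... | no ¬all = find (¬All⇒Any¬ (_∈? S) u ¬all)

Reduced-↾ : ∀ u S → Reduced u → Reduced (u ↾ S)
Reduced-↾ u S red x x∈ with ∈-↾⁻ u S x∈
... | x∈u , x∈S = subst (2 ≤_) (sym (count-↾ u S x∈S)) (red x x∈u)


-- Sequences of length at most eight

Reduced-pullback : ∀ {u c} → Isomorphic u c → Reduced u → Reduced c
Reduced-pullback {c = c} (g , inj , refl) red i i∈ =
  subst (2 ≤_) (count-map g c inj i∈) (red (g i) (∈-map⁺ g i∈))

reduced? : Seq → Bool
reduced? c = all (λ i → 2 ≤ᵇ count i c) c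

reduced?-complete : ∀ c → Reduced c → T (reduced? c)
reduced?-complete c red = all⁻ _ (All.tabulate λ {i} i∈ → ≤⇒≤ᵇ (red i i∈))

realizable?-canon : ∀ ds {u} → Realizable ds u → T (realizable? ds [] (canon u))
realizable?-canon ds (v , runs , f , inj , refl) with canon-isomorphic v
... | g , _ , decode rewrite canon-map f v inj =
  realizable?-sound g ds [] (canon v) [] (subst (Runs ds) (sym decode) runs)

directions : List Dir
directions = inc ∷ dec ∷ []

allRealizable₃? : Seq → Bool
allRealizable₃? c =
  all (λ d₁ → all (λ d₂ → all (λ d₃ → realizable? (d₁ ∷ d₂ ∷ d₃ ∷ []) [] c) directions) directions) directions

allRealizable₃?-canon : ∀ {u} → AllRealizable₃ u → T (allRealizable₃? (canon u))
allRealizable₃?-canon real =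
  all⁻ _ (All.universal (λ d₁ → all⁻ _ (All.universal (λ d₂ → all⁻ _ (All.universal (λ d₃ →
    realizable?-canon (d₁ ∷ d₂ ∷ d₃ ∷ []) (real d₁ d₂ d₃)) directions)) directions)) directions)

shortRealizable : List Seq
shortRealizable =
  (0 ∷ 0 ∷ []) ∷ s-aaa ∷ s-aabb ∷ (0 ∷ 1 ∷ 0 ∷ 1 ∷ []) ∷ s-abba
  ∷ (0 ∷ 1 ∷ 2 ∷ 0 ∷ 1 ∷ 2 ∷ []) ∷ s-abcacb ∷ s-abcbac ∷ s-abccab
  ∷ (0 ∷ 1 ∷ 2 ∷ 3 ∷ 0 ∷ 1 ∷ 2 ∷ 3 ∷ []) ∷ s-abcdbadc ∷ []

survivor? : Seq → Bool
survivor? c = reduced? c ∧ allRealizable₃? c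

searchComplete? : ℕ → Bool
searchComplete? n = all (λ c → not (survivor? c) ∨ isYes (c ∈ₛ? shortRealizable)) (growthStrings n 0)

searchComplete : ∀ n → 1 ≤ n → n ≤ 8 → T (searchComplete? n)
searchComplete 0 () _
searchComplete 1 _ _ = _
searchComplete 2 _ _ = _
searchComplete 3 _ _ = _
searchComplete 4 _ _ = _
searchComplete 5 _ _ = _
searchComplete 6 _ _ = _
searchComplete 7 _ _ = _
searchComplete 8 _ _ = _
searchComplete (suc (suc (suc (suc (suc (suc (suc (suc (suc _))))))))) _
  (s≤s (s≤s (s≤s (s≤s (s≤s (s≤s (s≤s (s≤s ()))))))))

-- opaque: unfolding the proof would re-run the search
opaque
  short-classification : ∀ {u} → Reduced u → AllRealizable₃ u → 1 ≤ length u → length u ≤ 8 →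
                         ∃[ c ] (c ∈ shortRealizable × Isomorphic u c)
  short-classification {u} red real 1≤n n≤8
    with Equivalence.to T-∨ (All.lookup (all⁺ _ _ (searchComplete (length u) 1≤n n≤8)) (canon-growthString u))
  ... | inj₂ listed = canon u , toWitness listed , canon-isomorphic u
  ... | inj₁ notSurvivor = ⊥-elim (T-not notSurvivor survivor)
    where
    survivor : T (survivor? (canon u))
    survivor = Equivalence.from T-∧
      (reduced?-complete (canon u) (Reduced-pullback (canon-isomorphic u) red) , allRealizable₃?-canon real)
    T-not : ∀ {b} → T (not b) → T b → ⊥
    T-not {true} () _

restriction-classification :
  ∀ {u} S {k x} → Reduced u → AllRealizable₃ u → (∀ {y} → y ∈ u → count y u ≤ k) → length S * k ≤ 8 →
  x ∈ u → x ∈ S → ∃[ c ] (c ∈ shortRealizable × Isomorphic (u ↾ S) c)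
restriction-classification {u} S red real bounded short x∈u x∈S =
  short-classification (Reduced-↾ u S red) (AllRealizable₃-resp-⊆ (↾-⊆ u S) real)
    (nonempty (∈-↾⁺ x∈u x∈S)) (≤-trans (length-↾-≤ u S (count-bounded u bounded)) short)
  where
  nonempty : ∀ {x} {w : Seq} → x ∈ w → 1 ≤ length w
  nonempty (here _) = s≤s z≤n
  nonempty (there _) = s≤s z≤n


-- Crossing and nested pairs

Shape : (ℕ → ℕ → Seq) → Seq → ℕ → ℕ → Set
Shape w u a b = u ↾ (a ∷ b ∷ []) ≡ w a b ⊎ u ↾ (a ∷ b ∷ []) ≡ w b a

crossing nesting : ℕ → ℕ → Seq
crossing a b = a ∷ b ∷ a ∷ b ∷ []
nesting a b = a ∷ b ∷ b ∷ a ∷ []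

Crossing Nested : Seq → ℕ → ℕ → Set
Crossing = Shape crossing
Nested = Shape nesting

AllCrossing : Seq → Set
AllCrossing u = ∀ {a b} → a ∈ u → b ∈ u → a ≢ b → Crossing u a b

Shape? : ∀ w u a b → Dec (Shape w u a b)
Shape? w u a b = ≡-dec _≟_ (u ↾ (a ∷ b ∷ [])) (w a b) ⊎-dec ≡-dec _≟_ (u ↾ (a ∷ b ∷ [])) (w b a)

crossing-nesting-disjoint : ∀ u {a b} → Crossing u a b → Nested u a b → a ≡ b
crossing-nesting-disjoint _ (inj₁ e₁) (inj₁ e₂) = cong (λ w → nth w 2) (trans (sym e₁) e₂)
crossing-nesting-disjoint _ (inj₁ e₁) (inj₂ e₂) = cong (λ w → nth w 0) (trans (sym e₁) e₂)
crossing-nesting-disjoint _ (inj₂ e₁) (inj₁ e₂) = cong (λ w → nth w 0) (trans (sym e₂) e₁)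
crossing-nesting-disjoint _ (inj₂ e₁) (inj₂ e₂) = cong (λ w → nth w 2) (trans (sym e₂) e₁)

Shape-map : ∀ w → (∀ h a b → map h (w a b) ≡ w (h a) (h b)) → ∀ h c {i j} →
            InjectiveOn h c → i ∈ c → j ∈ c → Shape w c i j → Shape w (map h c) (h i) (h j)
Shape-map w natural h c {i} {j} inj i∈ j∈ = Sum.map (lift i j) (lift j i)
  where
  inj′ : InjectiveOn h ((i ∷ j ∷ []) ++ c)
  inj′ = InjectiveOn-⊆ (λ { (here refl) → i∈ ; (there (here refl)) → j∈ ; (there (there z∈)) → z∈ }) inj
  lift : ∀ x y → c ↾ (i ∷ j ∷ []) ≡ w x y → map h c ↾ (h i ∷ h j ∷ []) ≡ w (h x) (h y)
  lift x y eq = trans (↾-map h (i ∷ j ∷ []) c inj′) (trans (cong (map h) eq) (natural h x y))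

Shape-↾ : ∀ w u S {a b} → a ∈ S → b ∈ S → Shape w (u ↾ S) a b → Shape w u a b
Shape-↾ w u S {a} {b} a∈ b∈ = subst (λ v → v ≡ w a b ⊎ v ≡ w b a) (↾-↾ u pair⊆S)
  where
  pair⊆S : ∀ {x} → x ∈ a ∷ b ∷ [] → x ∈ S
  pair⊆S (here refl) = a∈
  pair⊆S (there (here refl)) = b∈

pattern 1st = here refl
pattern 2nd = there 1st
pattern 3rd = there 2nd
pattern 4th = there 3rd
pattern 5th = there 4th
pattern 6th = there 5th
pattern 7th = there 6th
pattern 8th = there 7th
pattern 9th = there 8th
pattern 10th = there 9th
pattern 11th = there 10th

module _ u S {c h} (inj : InjectiveOn h c) (restricts : map h c ≡ u ↾ S) where

  preimages : All (_∈ u) S → All (λ x → ∃[ i ] (i ∈ c × x ≡ h i)) S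
  preimages S⊆u = All.tabulate λ x∈S → ∈-map⁻ h (subst (_ ∈_) (sym restricts) (∈-↾⁺ (All.lookup S⊆u x∈S) x∈S))

  count-lift : ∀ {i} → i ∈ c → h i ∈ S → count (h i) u ≡ count i c
  count-lift i∈ hi∈S =
    trans (sym (count-↾ u S hi∈S)) (trans (cong (count _) (sym restricts)) (count-map h c inj i∈))

  Shape-lift : ∀ w → (∀ h a b → map h (w a b) ≡ w (h a) (h b)) → ∀ {i j} → i ∈ c → j ∈ c → h i ∈ S → h j ∈ S →
               Shape w c i j → Shape w u (h i) (h j)
  Shape-lift w natural i∈ j∈ hi∈S hj∈S shape =
    Shape-↾ w u S hi∈S hj∈S
      (subst (λ v → Shape w v (h _) (h _)) restricts (Shape-map w natural h c inj i∈ j∈ shape))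

  Crossing-lift : ∀ {i j} → i ∈ c → j ∈ c → h i ∈ S → h j ∈ S → Crossing c i j → Crossing u (h i) (h j)
  Crossing-lift = Shape-lift crossing (λ _ _ _ → refl)

  Nested-lift : ∀ {i j} → i ∈ c → j ∈ c → h i ∈ S → h j ∈ S → Nested c i j → Nested u (h i) (h j)
  Nested-lift = Shape-lift nesting (λ _ _ _ → refl)

-- decided by evaluation, hence opaque like short-classification
opaque
  shortRealizable-count≤3 : ∀ {c i} → c ∈ shortRealizable → i ∈ c → count i c ≤ 3
  shortRealizable-count≤3 c∈ i∈ =
    All.lookup (All.lookup (toWitness {a? = all? (λ c → all? (λ i → count i c ≤? 3) c) shortRealizable} _) c∈) i∈

  shortRealizable-count≡2 : ∀ {c i j} → c ∈ shortRealizable → i ∈ c → j ∈ c → i ≢ j → count i c ≡ 2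
  shortRealizable-count≡2 c∈ i∈ j∈ =
    All.lookup (All.lookup (All.lookup (toWitness {a? = all? (λ c → all? (λ i → all? (λ j →
      ¬? (i ≟ j) →-dec count i c ≟ 2) c) c) shortRealizable} _) c∈) i∈) j∈

  shortRealizable-crossingOrNested :
    ∀ {c i j k} → c ∈ shortRealizable → i ∈ c → j ∈ c → k ∈ c →
    Unique (k ∷ j ∷ i ∷ []) → Crossing c i j ⊎ Nested c i j
  shortRealizable-crossingOrNested c∈ i∈ j∈ k∈ =
    All.lookup (All.lookup (All.lookup (All.lookup (toWitness {a? = all? (λ c → all? (λ i → all? (λ j →
      all? (λ k → unique? (k ∷ j ∷ i ∷ []) →-dec (Shape? crossing c i j ⊎-dec Shape? nesting c i j))
      c) c) c) shortRealizable} _) c∈) i∈) j∈) k∈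

  shortRealizable-nestedPairs :
    ∀ {c i j k l} → c ∈ shortRealizable → i ∈ c → j ∈ c → k ∈ c → l ∈ c →
    Unique (l ∷ k ∷ j ∷ i ∷ []) → Crossing c i j ⊎ Nested c k l
  shortRealizable-nestedPairs c∈ i∈ j∈ k∈ l∈ =
    All.lookup (All.lookup (All.lookup (All.lookup (All.lookup (toWitness {a? = all? (λ c → all? (λ i → all? (λ j →
      all? (λ k → all? (λ l →
        unique? (l ∷ k ∷ j ∷ i ∷ []) →-dec (Shape? crossing c i j ⊎-dec Shape? nesting c k l))
      c) c) c) c) shortRealizable} _) c∈) i∈) j∈) k∈) l∈

  shortRealizable-nestedOnce :
    ∀ {c i j k l} → c ∈ shortRealizable → i ∈ c → j ∈ c → k ∈ c → l ∈ c →
    Unique (k ∷ j ∷ i ∷ l ∷ []) → Crossing c i j ⊎ Crossing c i k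
  shortRealizable-nestedOnce c∈ i∈ j∈ k∈ l∈ =
    All.lookup (All.lookup (All.lookup (All.lookup (All.lookup (toWitness {a? = all? (λ c → all? (λ i → all? (λ j →
      all? (λ k → all? (λ l →
        unique? (k ∷ j ∷ i ∷ l ∷ []) →-dec (Shape? crossing c i j ⊎-dec Shape? crossing c i k))
      c) c) c) c) shortRealizable} _) c∈) i∈) j∈) k∈) l∈


-- Longer sequences

∉-Unique : ∀ {z : ℕ} {S} → z ∉ S → Unique S → Unique (z ∷ S)
∉-Unique {S = S} z∉ unique = ¬Any⇒All¬ S z∉ ∷ unique

Twice : Seq → Set
Twice u = ∀ {x} → x ∈ u → count x u ≡ 2

module _ {u} (red : Reduced u) (real : AllRealizable₃ u) where

  count≤3 : ∀ {a} → a ∈ u → count a u ≤ 3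
  count≤3 {a} a∈ with count a u ≤? 3
  ... | yes ≤3 = ≤3
  ... | no ≰3
    with short-classification reduced (AllRealizable₃-resp-⊆ (replicate-⊆ 4 u (≰⇒> ≰3)) real)
                              (s≤s z≤n) (≤ᵇ⇒≤ 4 8 _)
    where
    reduced : Reduced (replicate 4 a)
    reduced y y∈ with All.lookup (replicate⁺ {P = a ≡_} 4 refl) y∈
    ... | refl = subst (2 ≤_) (sym (count-replicate a 4)) (≤ᵇ⇒≤ 2 4 _)
  ... | c , c∈ , h , inj , eq with ∈-map⁻ h (subst (a ∈_) (sym eq) (here refl))
  ...   | i , i∈ , refl = ⊥-elim (<⇒≱ (≤ᵇ⇒≤ 4 4 _) (subst (_≤ 3) count≡4 (shortRealizable-count≤3 c∈ i∈)))
    where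
    count≡4 : count i c ≡ 4
    count≡4 = trans (sym (count-map h c inj i∈)) (trans (cong (count (h i)) eq) (count-replicate (h i) 4))

  restriction : ∀ {k} s S → (∀ {y} → y ∈ u → count y u ≤ k) → length (s ∷ S) * k ≤ 8 → All (_∈ u) (s ∷ S) →
                ∃[ c ] (c ∈ shortRealizable × Isomorphic (u ↾ (s ∷ S)) c)
  restriction s S bounded short (s∈ ∷ _) = restriction-classification (s ∷ S) red real bounded short s∈ (here refl)

  count≡2 : ∀ {a b} → a ∈ u → b ∈ u → a ≢ b → count a u ≡ 2
  count≡2 {a} {b} a∈ b∈ a≢b with restriction a (b ∷ []) count≤3 (≤ᵇ⇒≤ 6 8 _) (a∈ ∷ b∈ ∷ [])
  ... | c , c∈ , h , inj , eq with preimages u _ inj eq (a∈ ∷ b∈ ∷ [])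
  ...   | (i , i∈ , refl) ∷ (j , j∈ , refl) ∷ [] =
    trans (count-lift u (a ∷ b ∷ []) inj eq i∈ 1st) (shortRealizable-count≡2 c∈ i∈ j∈ (a≢b ∘ cong h))

  twice : 3 < length u → Twice u
  twice long {x} x∈ with fresh-letter u (x ∷ []) count≤3 long
  ... | y , y∈ , y∉ = count≡2 x∈ y∈ (λ { refl → y∉ (here refl) })

  module _ (two : Twice u) where

    private
      count≤2 : ∀ {y} → y ∈ u → count y u ≤ 2
      count≤2 = ≤-reflexive ∘ two

    crossingOrNested : ∀ {a b z} → a ∈ u → b ∈ u → z ∈ u → Unique (z ∷ b ∷ a ∷ []) →
                       Crossing u a b ⊎ Nested u a b
    crossingOrNested {a} {b} {z} a∈ b∈ z∈ distinct
      with restriction a (b ∷ z ∷ []) count≤2 (≤ᵇ⇒≤ 6 8 _) (a∈ ∷ b∈ ∷ z∈ ∷ [])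
    ... | c , c∈ , h , inj , eq with preimages u _ inj eq (a∈ ∷ b∈ ∷ z∈ ∷ [])
    ... | (i , i∈ , refl) ∷ (j , j∈ , refl) ∷ (k , k∈ , refl) ∷ [] =
      Sum.map (Crossing-lift u S inj eq i∈ j∈ 1st 2nd) (Nested-lift u S inj eq i∈ j∈ 1st 2nd)
              (shortRealizable-crossingOrNested c∈ i∈ j∈ k∈ (Uniqueₚ.map⁻ distinct))
      where S = a ∷ b ∷ z ∷ []

    nested-transfer : ∀ {a b z w} → a ∈ u → b ∈ u → z ∈ u → w ∈ u → Unique (w ∷ z ∷ b ∷ a ∷ []) →
                      Nested u a b → Nested u z w
    nested-transfer {a} {b} {z} {w} a∈ b∈ z∈ w∈ distinct@(_ ∷ _ ∷ (b≢a ∷ []) ∷ _) nested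
      with restriction a (b ∷ z ∷ w ∷ []) count≤2 (≤ᵇ⇒≤ 8 8 _) (a∈ ∷ b∈ ∷ z∈ ∷ w∈ ∷ [])
    ... | c , c∈ , h , inj , eq with preimages u _ inj eq (a∈ ∷ b∈ ∷ z∈ ∷ w∈ ∷ [])
    ... | (i , i∈ , refl) ∷ (j , j∈ , refl) ∷ (k , k∈ , refl) ∷ (l , l∈ , refl) ∷ []
      with shortRealizable-nestedPairs c∈ i∈ j∈ k∈ l∈ (Uniqueₚ.map⁻ distinct)
    ... | inj₂ nested-kl = Nested-lift u S inj eq k∈ l∈ 3rd 4th nested-kl
      where S = a ∷ b ∷ z ∷ w ∷ []
    ... | inj₁ crossing-ij =
      ⊥-elim (b≢a (sym (crossing-nesting-disjoint u (Crossing-lift u S inj eq i∈ j∈ 1st 2nd crossing-ij) nested)))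
      where S = a ∷ b ∷ z ∷ w ∷ []

    ¬nested-twice : ∀ {a z w t} → a ∈ u → z ∈ u → w ∈ u → t ∈ u → Unique (t ∷ w ∷ z ∷ a ∷ []) →
                    Nested u z w → Nested u z t → ⊥
    ¬nested-twice {a} {z} {w} {t} a∈ z∈ w∈ t∈ distinct@((_ ∷ t≢z ∷ _) ∷ (w≢z ∷ _) ∷ _) nested-zw nested-zt
      with restriction z (w ∷ t ∷ a ∷ []) count≤2 (≤ᵇ⇒≤ 8 8 _) (z∈ ∷ w∈ ∷ t∈ ∷ a∈ ∷ [])
    ... | c , c∈ , h , inj , eq with preimages u _ inj eq (z∈ ∷ w∈ ∷ t∈ ∷ a∈ ∷ [])
    ... | (i , i∈ , refl) ∷ (j , j∈ , refl) ∷ (k , k∈ , refl) ∷ (l , l∈ , refl) ∷ []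
      with shortRealizable-nestedOnce c∈ i∈ j∈ k∈ l∈ (Uniqueₚ.map⁻ distinct)
    ... | inj₁ crossing-ij =
      w≢z (sym (crossing-nesting-disjoint u (Crossing-lift u S inj eq i∈ j∈ 1st 2nd crossing-ij) nested-zw))
      where S = z ∷ w ∷ t ∷ a ∷ []
    ... | inj₂ crossing-ik =
      t≢z (sym (crossing-nesting-disjoint u (Crossing-lift u S inj eq i∈ k∈ 1st 3rd crossing-ik) nested-zt))
      where S = z ∷ w ∷ t ∷ a ∷ []

    -- If a and b nested, so would every pair of other letters, and z would nest with both w and t.
    all-crossing : 8 < length u → AllCrossing u
    all-crossing long {a} {b} a∈ b∈ a≢b
      with fresh-letter u (b ∷ a ∷ []) count≤2 (≤-<-trans (≤ᵇ⇒≤ 4 8 _) long)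
    ... | z , z∈ , z∉
      with crossingOrNested a∈ b∈ z∈ (∉-Unique z∉ (((a≢b ∘ sym) ∷ []) ∷ [] ∷ []))
    ... | inj₁ crossing = crossing
    ... | inj₂ nested
      with fresh-letter u (z ∷ b ∷ a ∷ []) count≤2 (≤-<-trans (≤ᵇ⇒≤ 6 8 _) long)
    ... | w , w∈ , w∉
      with fresh-letter u (w ∷ z ∷ b ∷ a ∷ []) count≤2 long
    ... | t , t∈ , t∉ =
      ⊥-elim (¬nested-twice a∈ z∈ w∈ t∈ (AllPairs-resp-⊆ (refl ∷ refl ∷ refl ∷ b ∷ʳ ⊆-refl) distinct)
                (nested-transfer a∈ b∈ z∈ w∈ (AllPairs-resp-⊆ (t ∷ʳ ⊆-refl) distinct) nested)
                (nested-transfer a∈ b∈ z∈ t∈ (AllPairs-resp-⊆ (refl ∷ w ∷ʳ ⊆-refl) distinct) nested))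
      where
      distinct : Unique (t ∷ w ∷ z ∷ b ∷ a ∷ [])
      distinct = ∉-Unique t∉ (∉-Unique w∉ (∉-Unique z∉ (((a≢b ∘ sym) ∷ []) ∷ [] ∷ [])))


-- Squares

first-occurrence : ∀ {x} t → x ∈ t → ∃[ A ] ∃[ B ] (t ≡ A ++ x ∷ B × x ∉ A)
first-occurrence {x} (y ∷ t) x∈ with x ≟ y
... | yes refl = [] , t , refl , λ ()
... | no x≢y with x∈
...   | here x≡y = ⊥-elim (x≢y x≡y)
...   | there x∈t with first-occurrence t x∈t
...     | A , B , refl , x∉A = y ∷ A , B , refl , λ { (here x≡y) → x≢y x≡y ; (there x∈A) → x∉A x∈A }

++-≡-++ : ∀ (P Q R S : List A) → P ++ Q ≡ R ++ S →
          ∃[ E ] ((R ≡ P ++ E × Q ≡ E ++ S) ⊎ (P ≡ R ++ E × S ≡ E ++ Q))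
++-≡-++ [] Q R S eq = R , inj₁ (refl , eq)
++-≡-++ (p ∷ P) Q [] S eq = p ∷ P , inj₂ (refl , sym eq)
++-≡-++ (p ∷ P) Q (r ∷ R) S eq with ∷-injective eq
... | refl , eq′ with ++-≡-++ P Q R S eq′
...   | E , inj₁ (R≡ , Q≡) = E , inj₁ (cong (p ∷_) R≡ , Q≡)
...   | E , inj₂ (P≡ , S≡) = E , inj₂ (cong (p ∷_) P≡ , S≡)

square-halves : ∀ A B p → A ++ B ≡ p ++ p →
                (∀ {y} → y ∈ A → count y A ≡ 1) → (∀ {y} → y ∈ B → count y B ≡ 1) → A ≡ p × B ≡ p
square-halves A B p eq onceA onceB with ++-≡-++ A B p p eq
... | [] , inj₁ (p≡ , _) = A≡p , ++-cancelˡ A B p (trans eq (cong (_++ p) (sym A≡p)))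
  where A≡p = sym (trans p≡ (++-identityʳ A))
... | [] , inj₂ (A≡ , _) = A≡p , ++-cancelˡ A B p (trans eq (cong (_++ p) (sym A≡p)))
  where A≡p = trans A≡ (++-identityʳ p)
... | y ∷ E , inj₁ (refl , B≡) =
  ⊥-elim (count≡1⇒∉ y _ (subst (λ w → count y w ≡ 1) B≡ (onceB (subst (y ∈_) (sym B≡) (here refl))))
                      (∈-++⁺ʳ E (∈-++⁺ʳ A (here refl))))
... | y ∷ E , inj₂ (A≡ , refl) =
  ⊥-elim (count≡1⇒∉ y _ (subst (λ w → count y w ≡ 1) A≡ (onceA (subst (y ∈_) (sym A≡) (here refl))))
                      (∈-++⁺ʳ (E ++ B) (here refl)))

private
  middle : ∀ {x y : ℕ} (P Q : Seq) → x ∉ P → x ≢ y → P ++ x ∷ Q ≡ y ∷ x ∷ y ∷ [] → P ≡ [ y ] × Q ≡ [ y ]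
  middle [] Q _ x≢y eq = ⊥-elim (x≢y (∷-injectiveˡ eq))
  middle (p ∷ []) Q _ _ refl = refl , refl
  middle (p ∷ p′ ∷ P) Q x∉ _ eq = ⊥-elim (x∉ (there (here (sym (∷-injectiveˡ (∷-injectiveʳ eq))))))

-- x is the first letter of u = x A x B.  Every other letter y alternates with x, so the restriction
-- of u to {x, y} is x y x y: y occurs once in A and once in B.
module Peel {x A B} (x∉A : x ∉ A) (two : Twice (x ∷ A ++ x ∷ B)) (cross : AllCrossing (x ∷ A ++ x ∷ B)) where

  x∉B : x ∉ B
  x∉B = count≡1⇒∉ x B (suc-injective (begin
    suc (count x (x ∷ B))              ≡⟨ cong (λ n → suc (n + _)) (count-∉ A x∉A) ⟨
    suc (count x A + count x (x ∷ B))  ≡⟨ cong suc (count-++ x A (x ∷ B)) ⟨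
    suc (count x (A ++ x ∷ B))         ≡⟨ count-≡ x (A ++ x ∷ B) ⟨
    count x (x ∷ A ++ x ∷ B)           ≡⟨ two (here refl) ⟩
    2                                  ∎))
    where open ≡-Reasoning

  ≢x : ∀ {y} → y ∈ A ++ B → y ≢ x
  ≢x y∈ refl with ∈-++⁻ A y∈
  ... | inj₁ x∈A = x∉A x∈A
  ... | inj₂ x∈B = x∉B x∈B

  ⊆u : ∀ {y} → y ∈ A ++ B → y ∈ x ∷ A ++ x ∷ B
  ⊆u y∈ with ∈-++⁻ A y∈
  ... | inj₁ y∈A = there (∈-++⁺ˡ y∈A)
  ... | inj₂ y∈B = there (∈-++⁺ʳ A (there y∈B))

  ↾-peel : ∀ S → x ∉ S → (x ∷ A ++ x ∷ B) ↾ S ≡ (A ++ B) ↾ S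
  ↾-peel S x∉S = begin
    (x ∷ A ++ x ∷ B) ↾ S  ≡⟨ ↾-∷-∉ x _ S x∉S ⟩
    (A ++ x ∷ B) ↾ S      ≡⟨ ↾-++ A (x ∷ B) S ⟩
    A ↾ S ++ (x ∷ B) ↾ S  ≡⟨ cong (A ↾ S ++_) (↾-∷-∉ x B S x∉S) ⟩
    A ↾ S ++ B ↾ S        ≡⟨ ↾-++ A B S ⟨
    (A ++ B) ↾ S          ∎
    where open ≡-Reasoning

  count-peel : ∀ {y} → y ≢ x → count y (x ∷ A ++ x ∷ B) ≡ count y (A ++ B)
  count-peel {y} y≢x = begin
    count y (x ∷ A ++ x ∷ B)           ≡⟨ count-≢ _ y≢x ⟩
    count y (A ++ x ∷ B)               ≡⟨ count-++ y A (x ∷ B) ⟩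
    count y A + count y (x ∷ B)        ≡⟨ cong (count y A +_) (count-≢ B y≢x) ⟩
    count y A + count y B              ≡⟨ count-++ y A B ⟨
    count y (A ++ B)                   ∎
    where open ≡-Reasoning

  rest-twice : Twice (A ++ B)
  rest-twice y∈ = trans (sym (count-peel (≢x y∈))) (two (⊆u y∈))

  rest-crossing : AllCrossing (A ++ B)
  rest-crossing {a} {b} a∈ b∈ a≢b =
    subst (λ v → v ≡ _ ⊎ v ≡ _) (↾-peel (a ∷ b ∷ []) x∉ab) (cross (⊆u a∈) (⊆u b∈) a≢b)
    where
    x∉ab : x ∉ a ∷ b ∷ []
    x∉ab (here refl) = ≢x a∈ refl
    x∉ab (there (here refl)) = ≢x b∈ refl

  ↾-split : ∀ S → x ∈ S → (x ∷ A ++ x ∷ B) ↾ S ≡ x ∷ A ↾ S ++ x ∷ B ↾ S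
  ↾-split S x∈S =
    trans (↾-∷-∈ x _ S x∈S) (cong (x ∷_) (trans (↾-++ A (x ∷ B) S) (cong (A ↾ S ++_) (↾-∷-∈ x B S x∈S))))

  once-each : ∀ {y} → y ∈ A ++ B → A ↾ (x ∷ y ∷ []) ≡ [ y ] × B ↾ (x ∷ y ∷ []) ≡ [ y ]
  once-each {y} y∈ with cross (here refl) (⊆u y∈) (≢x y∈ ∘ sym)
  ... | inj₂ eq = ⊥-elim (≢x y∈ (sym (∷-injectiveˡ (trans (sym (↾-split _ (here refl))) eq))))
  ... | inj₁ eq = middle (A ↾ S) (B ↾ S) (x∉A ∘ proj₁ ∘ ∈-↾⁻ A S) (≢x y∈ ∘ sym)
                         (∷-injectiveʳ (trans (sym (↾-split S (here refl))) eq))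
    where S = x ∷ y ∷ []

  count-A : ∀ {y} → y ∈ A ++ B → count y A ≡ 1
  count-A {y} y∈ = trans (sym (count-↾ A _ 2nd)) (trans (cong (count y) (proj₁ (once-each y∈))) (count-≡ y []))

  count-B : ∀ {y} → y ∈ A ++ B → count y B ≡ 1
  count-B {y} y∈ = trans (sym (count-↾ B _ 2nd)) (trans (cong (count y) (proj₂ (once-each y∈))) (count-≡ y []))

Twice-head : ∀ {x t} → Twice (x ∷ t) → x ∈ t
Twice-head {x} {t} two =
  count>0⇒∈ t (subst (1 ≤_) (sym (suc-injective (trans (sym (count-≡ x t)) (two 1st)))) (s≤s z≤n))

square : ∀ u → Twice u → AllCrossing u → ∃[ p ] (u ≡ p ++ p × Unique p)
square u = go (length u) u ≤-refl
  where
  go : ∀ n u → length u ≤ n → Twice u → AllCrossing u → ∃[ p ] (u ≡ p ++ p × Unique p)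
  go _ [] _ _ _ = [] , refl , []
  go (suc n) (x ∷ t) (s≤s len) two cross with first-occurrence t (Twice-head two)
  ... | A , B , refl , x∉A
    with go n (A ++ B) (≤-trans (length-mono-≤ (++⁺ (⊆-refl {x = A}) (x ∷ʳ ⊆-refl {x = B}))) len)
            rest-twice rest-crossing
    where open Peel x∉A two cross
  ... | p , A++B≡p++p , unique with square-halves A B p A++B≡p++p (count-A ∘ ∈-++⁺ˡ) (count-B ∘ ∈-++⁺ʳ A)
    where open Peel x∉A two cross
  ... | refl , refl = x ∷ A , refl , ¬Any⇒All¬ A x∉A ∷ unique

map-nth-upTo : ∀ p → map (nth p) (upTo (length p)) ≡ p
map-nth-upTo [] = refl
map-nth-upTo (x ∷ p) = cong (x ∷_) (begin
  map (nth (x ∷ p)) (applyUpTo suc (length p))  ≡⟨ cong (map (nth (x ∷ p))) (map-upTo suc (length p)) ⟨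
  map (nth (x ∷ p)) (map suc (upTo (length p)))           ≡⟨ map-∘ (upTo (length p)) ⟨
  map (nth p) (upTo (length p))                            ≡⟨ map-nth-upTo p ⟩
  p                                                        ∎)
  where open ≡-Reasoning

square-isomorphic : ∀ p → Unique p → Isomorphic (p ++ p) (up2 (length p))
square-isomorphic p unique = f , injective , (begin
  map f (half ++ half)      ≡⟨ map-++ f half half ⟩
  map f half ++ map f half  ≡⟨ cong₂ _++_ half↦p half↦p ⟩
  p ++ p                    ∎)
  where
  open ≡-Reasoning
  half = map suc (upTo (length p))
  f = nth p ∘ pred
  half↦p : map f half ≡ p
  half↦p = trans (sym (map-∘ (upTo (length p)))) (map-nth-upTo p)
  index : ∀ {x} → x ∈ half ++ half → ∃[ i ] (x ≡ suc i × i < length p)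
  index x∈ with ∈-++⁻ half x∈
  ... | inj₁ x∈ʰ with ∈-map⁻ suc x∈ʰ
  ...   | i , i∈ , refl = i , refl , ∈-upTo⁻ i∈
  index x∈ | inj₂ x∈ʰ with ∈-map⁻ suc x∈ʰ
  ...   | i , i∈ , refl = i , refl , ∈-upTo⁻ i∈
  injective : InjectiveOn f (half ++ half)
  injective x y x∈ y∈ fx≡fy with index x∈ | index y∈
  ... | i , refl , i< | j , refl , j< = cong suc (nth-injective p unique i< j< fx≡fy)


Isomorphic-suc : ∀ {u c} → Isomorphic u c → Isomorphic u (map suc c)
Isomorphic-suc {c = c} (f , injective , refl) = f ∘ pred , injective′ , sym (map-∘ c)
  where
  injective′ : InjectiveOn (f ∘ pred) (map suc c)
  injective′ x y x∈ y∈ eq with ∈-map⁻ suc x∈ | ∈-map⁻ suc y∈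
  ... | i , i∈ , refl | j , j∈ , refl = cong suc (injective i j i∈ j∈ eq)

forces-[] : FormationForces 0 []
forces-[] = 0 , λ w _ → [] , []⊆-universal w , (λ z → z) , (λ _ _ ()) , refl

forces-aa : ∀ x → FormationForces 2 (x ∷ x ∷ [])
forces-aa x = 1 , λ { w (a ∷ [] , _ , _ , b₁ ∷ b₂ ∷ [] , _ , p₁ ∷ p₂ ∷ [] , refl) → contains a p₁ p₂ }
  where
  contains : ∀ a {b₁ b₂} → b₁ ↭ [ a ] → b₂ ↭ [ a ] → Contains (concat (b₁ ∷ b₂ ∷ [])) (x ∷ x ∷ [])
  contains a p₁ p₂ with ↭-singleton-inv p₁ | ↭-singleton-inv p₂
  ... | refl | refl = a ∷ a ∷ [] , ⊆-refl , (λ _ → x) , injective , refl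
    where
    injective : InjectiveOn (λ _ → x) (a ∷ a ∷ [])
    injective _ _ y∈ z∈ _ = trans (All.lookup twiceA y∈) (sym (All.lookup twiceA z∈))
      where
      twiceA : All (_≡ a) (a ∷ a ∷ [])
      twiceA = refl ∷ refl ∷ []

Classified : Seq → Set
Classified u =
  (∃[ l ] (2 ≤ l × Isomorphic u (up2 l)))
  ⊎ Isomorphic u s-aaa ⊎ Isomorphic u s-aabb ⊎ Isomorphic u s-abba
  ⊎ Isomorphic u s-abcacb ⊎ Isomorphic u s-abcbac ⊎ Isomorphic u s-abccab
  ⊎ Isomorphic u s-abcdbadc

shortRealizable-classified : ∀ {u c} → ¬ FormationForces 2 u → c ∈ shortRealizable → Isomorphic u c → Classified u
shortRealizable-classified ¬forces₂ 1st (f , _ , refl) = ⊥-elim (¬forces₂ (forces-aa (f 0)))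
shortRealizable-classified _ 2nd iso = inj₂ (inj₁ iso)
shortRealizable-classified _ 3rd iso = inj₂ (inj₂ (inj₁ iso))
shortRealizable-classified _ 4th iso = inj₁ (2 , ≤ᵇ⇒≤ 2 2 _ , Isomorphic-suc iso)
shortRealizable-classified _ 5th iso = inj₂ (inj₂ (inj₂ (inj₁ iso)))
shortRealizable-classified _ 6th iso = inj₁ (3 , ≤ᵇ⇒≤ 2 3 _ , Isomorphic-suc iso)
shortRealizable-classified _ 7th iso = inj₂ (inj₂ (inj₂ (inj₂ (inj₁ iso))))
shortRealizable-classified _ 8th iso = inj₂ (inj₂ (inj₂ (inj₂ (inj₂ (inj₁ iso)))))
shortRealizable-classified _ 9th iso = inj₂ (inj₂ (inj₂ (inj₂ (inj₂ (inj₂ (inj₁ iso))))))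
shortRealizable-classified _ 10th iso = inj₁ (4 , ≤ᵇ⇒≤ 2 4 _ , Isomorphic-suc iso)
shortRealizable-classified _ 11th iso = inj₂ (inj₂ (inj₂ (inj₂ (inj₂ (inj₂ (inj₂ iso))))))

half-length : ∀ (p : Seq) → 8 < length (p ++ p) → 2 ≤ length p
half-length (_ ∷ _ ∷ _) _ = s≤s (s≤s z≤n)
half-length (_ ∷ []) (s≤s (s≤s ()))
half-length [] ()

square-classified : ∀ {u} → 8 < length u → ∃[ p ] (u ≡ p ++ p × Unique p) → ∃[ l ] (2 ≤ l × Isomorphic u (up2 l))
square-classified long (p , refl , unique) = length p , half-length p long , square-isomorphic p unique

long-classified : ∀ {u} → Reduced u → AllRealizable₃ u → 8 < length u → ∃[ l ] (2 ≤ l × Isomorphic u (up2 l))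
long-classified {u} red real long = square-classified long (square u two (all-crossing red real two long))
  where two = twice red real (≤-trans (≤ᵇ⇒≤ 4 9 _) long)

lemma2p8 : (u : Seq) → Reduced u → FwEq u 3 →
    (∃[ l ] (2 ≤ l × Isomorphic u (up2 l)))
    ⊎ Isomorphic u s-aaa ⊎ Isomorphic u s-aabb ⊎ Isomorphic u s-abba
    ⊎ Isomorphic u s-abcacb ⊎ Isomorphic u s-abcbac ⊎ Isomorphic u s-abccab
    ⊎ Isomorphic u s-abcdbadc
lemma2p8 [] _ (_ , minimal) = ⊥-elim (minimal 0 (s≤s z≤n) forces-[])
lemma2p8 u@(_ ∷ _) red (forces₃ , minimal) = classify (length u ≤? 8)
  where
  real : AllRealizable₃ u
  real d₁ d₂ d₃ = forces⇒realizable (d₁ ∷ d₂ ∷ d₃ ∷ []) forces₃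
  classify : Dec (length u ≤ 8) → Classified u
  classify (yes short) with short-classification red real (s≤s z≤n) short
  ... | c , c∈ , iso = shortRealizable-classified (minimal 2 (≤ᵇ⇒≤ 3 3 _)) c∈ iso
  classify (no ¬short) = inj₁ (long-classified red real (≰⇒> ¬short))
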